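{- Let $\mathcal{G}_n$ be the set of all simple loopless undirected graphs on the vertex set $\{v_1,\dots,v_n\}$, and let $L:\mathcal{G}_n\to\mathcal{G}_n$ be an idempotent ($L\circ L=L$) linear operator that strongly preserves (a) the set of $(\mathbb{Z}_2,+)$-cordial graphs, where $n\ge 4$; or (b) the set of $(\mathbb{Z}_2,\times)$-cordial graphs, where $n\ge 4$; or (c) the set of $(2,3)$-orientable graphs, where $n\ge 6$. Then $L$ is bijective.
   Context: $T:\mathcal{G}_n\to\mathcal{G}_n$ is a linear operator if $T(U\cup V)=T(U)\cup T(V)$ for all $U,V\in\mathcal{G}_n$ (union of edge sets) and $T$ maps the edgeless graph to the edgeless graph. $T$ preserves $\mathcal{X}\subseteq\mathcal{G}_n$ if $U\in\mathcal{X}\Rightarrow T(U)\in\mathcal{X}$, and strongly preserves $\mathcal{X}$ if it preserves both $\mathcal{X}$ and $\mathcal{G}_n\setminus\mathcal{X}$. A labeling of a finite set with labels in a finite set $\mathcal{A}$ is $\mathcal{A}$-friendly if the numbers of elements receiving any two labels differ by at most one; "friendly" means $\{0,1\}$-friendly. A graph $G=(V,E)$ is $(\mathbb{Z}_2,+)$-cordial (resp. $(\mathbb{Z}_2,\times)$-cordial) if there is a friendly $\{0,1\}$-labeling $f$ of the non-isolated vertices of $G$ such that the edge labeling $g(uv)=f(u)+f(v)\pmod 2$ (resp. $g(uv)=f(u)f(v)$) is a friendly labeling of $E$. A graph is $(2,3)$-orientable if there is an orientation of its edges and a friendly $\{0,1\}$-labeling $f$ of its non-isolated vertices such that the arc labeling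 $g(\overrightarrow{uv})=f(v)-f(u)\in\{ -1,0,1\}$ is $\mathbb{Z}_3$-friendly. -}

module Defs where

open import Data.Nat using (ℕ; zero; suc; _≤_; _<ᵇ_)
open import Data.Bool using (Bool; true; false; _∧_; _∨_; _xor_; not)
open import Data.Fin using (Fin; zero; suc; toℕ)
open import Data.Vec using (Vec; []; _∷_; lookup; zipWith; replicate)
open import Data.List using (List; length; filterᵇ; cartesianProduct; allFin)
open import Data.Bool.ListAction using (any)
open import Data.Product using (_×_; _,_; ∃)
open import Data.Unit using (⊤; tt)
open import Relation.Binary.PropositionalEquality using (_≡_)
open import Relation.Nullary using (¬_)

-- A simple loopless undirected graph on vertices Fin n (v₁..vₙ), stored
-- canonically as its upper-triangular adjacency data: a graph on suc n
-- vertices is the adjacency row of vertex 0 to vertices 1..n, together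
-- with a graph on the remaining n vertices.  Distinct edge sets are
-- distinct values, so propositional equality is graph equality.
Graph : ℕ → Set
Graph zero    = ⊤
Graph (suc n) = Vec Bool n × Graph n

adj : ∀ {n} → Graph n → Fin n → Fin n → Bool
adj {suc n} (r , g) zero    zero    = false
adj {suc n} (r , g) zero    (suc j) = lookup r j
adj {suc n} (r , g) (suc i) zero    = lookup r i
adj {suc n} (r , g) (suc i) (suc j) = adj g i j

_∪_ : ∀ {n} → Graph n → Graph n → Graph n
_∪_ {zero}  tt       tt       = tt
_∪_ {suc n} (r , g) (s , h) = zipWith _∨_ r s , (g ∪ h)

empty : ∀ {n} → Graph n
empty {zero}  = tt
empty {suc n} = replicate n false , empty

Linear : ∀ {n} → (Graph n → Graph n) → Set
Linear {n} T = (∀ (U V : Graph n) → T (U ∪ V) ≡ (T U ∪ T V)) × (T empty ≡ empty)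

StronglyPreserves : ∀ {n} → (Graph n → Set) → (Graph n → Graph n) → Set
StronglyPreserves {n} X T = ∀ (U : Graph n) → (X U → X (T U)) × (¬ X U → ¬ X (T U))

count : ∀ {A : Set} → (A → Bool) → List A → ℕ
count p xs = length (filterᵇ p xs)

Near : ℕ → ℕ → Set
Near a b = (a ≤ suc b) × (b ≤ suc a)

eqB : Bool → Bool → Bool
eqB true  true  = true
eqB false false = true
eqB _     _     = false

nonIsolated : ∀ {n} → Graph n → Fin n → Bool
nonIsolated {n} G v = any (adj G v) (allFin n)

edges : ∀ {n} → Graph n → List (Fin n × Fin n)
edges {n} G = filterᵇ (λ { (i , j) → (toℕ i <ᵇ toℕ j) ∧ adj G i j })
                      (cartesianProduct (allFin n) (allFin n))

-- labels 0,1 are false,true.  f is friendly on the non-isolated vertices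
VertexFriendly : ∀ {n} → Graph n → (Fin n → Bool) → Set
VertexFriendly {n} G f =
  Near (count (λ v → nonIsolated G v ∧ eqB (f v) false) (allFin n))
       (count (λ v → nonIsolated G v ∧ eqB (f v) true)  (allFin n))

EdgeFriendly : ∀ {n} → Graph n → (Bool → Bool → Bool) → (Fin n → Bool) → Set
EdgeFriendly G op f =
  Near (count (λ { (i , j) → eqB (op (f i) (f j)) false }) (edges G))
       (count (λ { (i , j) → eqB (op (f i) (f j)) true  }) (edges G))

Z2PlusCordial : ∀ {n} → Graph n → Set
Z2PlusCordial {n} G = ∃ λ (f : Fin n → Bool) → VertexFriendly G f × EdgeFriendly G _xor_ f

Z2TimesCordial : ∀ {n} → Graph n → Set
Z2TimesCordial {n} G = ∃ λ (f : Fin n → Bool) → VertexFriendly G f × EdgeFriendly G _∧_ f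

data Lab : Set where
  neg zer pos : Lab

eqL : Lab → Lab → Bool
eqL neg neg = true
eqL zer zer = true
eqL pos pos = true
eqL _   _   = false

-- f(head) - f(tail)
diffL : Bool → Bool → Lab
diffL false true  = pos
diffL true  false = neg
diffL _     _     = zer

-- An orientation assigns to each edge {i,j} (i < j) a direction:
-- o i j = true means the arc i → j, false means j → i.
arcLabel : ∀ {n} → (Fin n → Fin n → Bool) → (Fin n → Bool) → Fin n × Fin n → Lab
arcLabel o f (i , j) with o i j
... | true  = diffL (f i) (f j)
... | false = diffL (f j) (f i)

Z3Friendly : ∀ {n} → Graph n → (Fin n → Fin n → Bool) → (Fin n → Bool) → Set
Z3Friendly G o f =
  Near c₋ c₀ × Near c₀ c₊ × Near c₋ c₊
  where
  c : Lab → ℕ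
  c l = count (λ e → eqL (arcLabel o f e) l) (edges G)
  c₋ = c neg
  c₀ = c zer
  c₊ = c pos

Orientable23 : ∀ {n} → Graph n → Set
Orientable23 {n} G = ∃ λ (o : Fin n → Fin n → Bool) → ∃ λ (f : Fin n → Bool) →
  VertexFriendly G f × Z3Friendly G o f

{-# OPTIONS --safe #-}
-- A linear operator on graphs is monotone for the subgraph order and is determined by its values
-- on single edges. If L is idempotent and xy is an edge of L(ab), then L(xy) ⊆ L(L(ab)) = L(ab),
-- so adding xy to any graph H ⊇ ab leaves L(H) unchanged; a strong preserver of X therefore admits
-- no such H for which adding xy changes membership in X. Small witness graphs (K₂, 2K₂ and P₄ for
-- (Z₂,+); K₁,₃, P₄ and the paw for (Z₂,×); 2K₂, 3K₂ and P₄ ∪ K₂ for (2,3)-orientability) supply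
-- such an H for every edge xy ≠ ab, so L(ab) ⊆ ab, and also a graph to which adding ab itself
-- changes membership, so L(ab) ≠ ∅. Hence L fixes every edge and is the identity. The three
-- properties ignore isolated vertices and are invariant under injective relabelling, so the
-- witnesses are checked on 4 or 6 vertices by exhaustive search and transported into Gₙ.
module Submission where

open import Defs

open import Data.Bool using (Bool; true; false; _∧_; _∨_; _xor_; not; if_then_else_; T)
open import Data.Bool.Properties using (xor-comm; ∧-comm; ∧-assoc; ∧-zeroʳ; not-involutive; T-∨; T-∧)
open import Data.Bool.ListAction using (any)
open import Data.Empty using (⊥; ⊥-elim)
open import Data.Fin using (Fin; zero; suc; toℕ; #_; _↑ʳ_)
import Data.Fin as Fin
open import Data.Fin.Properties using (_≟_; <-cmp; any?; all?; ¬∀⟶∃¬; injective⇒≤; ↑ʳ-injective)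
open import Data.List using (List; []; _∷_; map; foldr; filterᵇ; length; cartesianProduct; cartesianProductWith; allFin)
open import Data.List.Membership.Propositional using (_∈_; lose)
open import Data.List.Membership.Propositional.Properties
  using (∈-filter⁺; ∈-filter⁻; ∈-map⁺; ∈-map⁻; ∈-cartesianProduct⁺; ∈-cartesianProductWith⁺; ∈-allFin)
open import Data.List.Membership.Propositional.Properties.WithK using (unique∧set⇒bag)
open import Data.List.Relation.Binary.BagAndSetEquality using (∼bag⇒↭)
open import Data.List.Relation.Binary.Permutation.Propositional.Properties using (↭-length)
open import Data.List.Relation.Unary.Any using (here; there; satisfied)
import Data.List.Relation.Unary.Any as Any
open import Data.List.Relation.Unary.Any.Properties using (any⁺; any⁻)
open import Data.List.Relation.Unary.Unique.Propositional using (Unique)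
open import Data.List.Relation.Unary.Unique.Propositional.Properties using (filter⁺; map⁺; cartesianProduct⁺; allFin⁺)
open import Data.Nat using (ℕ; zero; suc; _+_; _*_; _<ᵇ_; _≤_; _<_; _≤?_; z≤n; s≤s)
import Data.Nat as ℕ
open import Data.Nat.Properties using (+-suc; +-identityʳ; *-cancelˡ-≡; +-mono-≤; ≤-trans; <⇒≤; <⇒≱; <⇒<ᵇ; <ᵇ⇒<)
open import Data.Product using (_×_; _,_; ∃; proj₁; proj₂; uncurry; swap)
import Data.Product as Product
open import Data.Sum using (_⊎_; inj₁; inj₂)
open import Data.Unit using (tt)
open import Data.Vec using ([]; _∷_; tabulate; lookup)
import Data.Vec.Functional as Vector
open import Data.Vec.Properties using (lookup∘tabulate; lookup-zipWith; lookup-replicate; tabulate∘lookup; tabulate-cong)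
open import Function using (_∘_; id; Bijective; _⇔_; mk⇔; Equivalence; _↣_; mk↣; Injection)
open Injection using (to; injective)
import Function.Properties.Equivalence as ⇔
open import Relation.Binary using (tri<; tri≈; tri>)
open import Relation.Binary.PropositionalEquality
  using (_≡_; _≢_; refl; sym; trans; cong; cong₂; subst; subst₂; _≗_; module ≡-Reasoning)
open import Relation.Nullary using (¬_; Dec; yes; no)
open import Relation.Nullary.Decidable
  using (T?; ⌊_⌋; toWitness; fromWitness; from-yes; from-no; decidable-stable; ¬?; _×-dec_; _⊎-dec_)

private variable
  k n : ℕ

Enumerates : {A : Set} → List A → Set
Enumerates xs = Unique xs × (∀ x → x ∈ xs)

allPairs : {A : Set} → List A → List (A × A)
allPairs xs = cartesianProduct xs xs

allFin-enumerates : Enumerates (allFin n)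
allFin-enumerates = allFin⁺ _ , ∈-allFin

allPairs-enumerates : {A : Set} {xs : List A} → Enumerates xs → Enumerates (allPairs xs)
allPairs-enumerates (u , c) = cartesianProduct⁺ u u , λ (x , y) → ∈-cartesianProduct⁺ (c x) (c y)

count-cong : {A : Set} {p q : A → Bool} (xs : List A) → (∀ {x} → x ∈ xs → p x ≡ q x) → count p xs ≡ count q xs
count-cong [] p≡q = refl
count-cong {p = p} {q} (x ∷ xs) p≡q with p x | q x | p≡q (here refl)
... | true  | true  | refl = cong suc (count-cong xs (p≡q ∘ there))
... | false | false | refl = count-cong xs (p≡q ∘ there)

count-map : {A B : Set} (p : B → Bool) (f : A → B) (xs : List A) → count p (map f xs) ≡ count (p ∘ f) xs
count-map p f [] = refl
count-map p f (x ∷ xs) with p (f x)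
... | true  = cong suc (count-map p f xs)
... | false = count-map p f xs

count-filterᵇ : {A : Set} (p q : A → Bool) (xs : List A) → count p (filterᵇ q xs) ≡ count (λ x → q x ∧ p x) xs
count-filterᵇ p q [] = refl
count-filterᵇ p q (x ∷ xs) with q x
... | false = count-filterᵇ p q xs
... | true with p x
...   | true  = cong suc (count-filterᵇ p q xs)
...   | false = count-filterᵇ p q xs

count-split : {A : Set} (r p : A → Bool) (xs : List A) →
  count p xs ≡ count (λ x → r x ∧ p x) xs + count (λ x → not (r x) ∧ p x) xs
count-split r p [] = refl
count-split r p (x ∷ xs) with r x | p x
... | true  | true  = cong suc (count-split r p xs)
... | false | true  = trans (cong suc (count-split r p xs)) (sym (+-suc _ _))
... | true  | false = count-split r p xs
... | false | false = count-split r p xs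

count-unique : {A : Set} (p : A → Bool) {xs ys : List A} → Unique xs → Unique ys →
  (∀ {x} → T (p x) → x ∈ xs ⇔ x ∈ ys) → count p xs ≡ count p ys
count-unique {A} p {xs} {ys} xs! ys! same =
  ↭-length (∼bag⇒↭ (unique∧set⇒bag (filter⁺ (T? ∘ p) xs!) (filter⁺ (T? ∘ p) ys!) (mk⇔ (move same) (move (⇔.sym ∘ same)))))
  where
  move : {us vs : List A} → (∀ {x} → T (p x) → x ∈ us ⇔ x ∈ vs) → ∀ {x} → x ∈ filterᵇ p us → x ∈ filterᵇ p vs
  move s x∈ with ∈-filter⁻ (T? ∘ p) x∈
  ... | x∈us , px = ∈-filter⁺ (T? ∘ p) (Equivalence.to (s px) x∈us) px

count-image : {A B : Set} (ι : A ↣ B) {xs : List A} {ys : List B} → Enumerates xs → Enumerates ys →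
  (p : B → Bool) → (∀ {y} → T (p y) → ∃ λ x → to ι x ≡ y) → count p ys ≡ count (p ∘ to ι) xs
count-image ι {xs} {ys} (xs! , xs-all) (ys! , ys-all) p on-image =
  trans (count-unique p ys! (map⁺ (injective ι) xs!) same) (count-map p (to ι) xs)
  where
  same : ∀ {y} → T (p y) → y ∈ ys ⇔ y ∈ map (to ι) xs
  same py with on-image py
  ... | x , refl = mk⇔ (λ _ → ∈-map⁺ (to ι) (xs-all x)) (λ _ → ys-all _)

Tournament : {A : Set} → (A → A → Bool) → Set
Tournament o = ∀ {x y} → x ≢ y → o y x ≡ not (o x y)

tournament-∘ : {A B : Set} {o : B → B → Bool} {f : A → B} → Tournament o → (∀ {x y} → f x ≡ f y → x ≡ y) →
  Tournament (λ x y → o (f x) (f y))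
tournament-∘ o-tour f-inj x≢y = o-tour (x≢y ∘ f-inj)

-- Each unordered pair {x , y} related by S is counted once, in the direction chosen by o.
count-tournament : {A : Set} {xs : List A} → Enumerates xs → (o S : A → A → Bool) → Tournament o →
  (∀ x y → S x y ≡ S y x) → (∀ x → S x x ≡ false) →
  2 * count (uncurry (λ x y → o x y ∧ S x y)) (allPairs xs) ≡ count (uncurry S) (allPairs xs)
count-tournament {A} {xs} enum o S o-tour S-sym S-irr = begin
  2 * count oS pairs                  ≡⟨ cong (count oS pairs +_) (+-identityʳ _) ⟩
  count oS pairs + count oS pairs     ≡⟨ cong (count oS pairs +_) swapped ⟩
  count oS pairs + count ¬oS pairs    ≡⟨ count-split (uncurry o) (uncurry S) pairs ⟨
  count (uncurry S) pairs             ∎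
  where
  open ≡-Reasoning
  pairs : List (A × A)
  pairs = allPairs xs
  oS ¬oS : A × A → Bool
  oS  = uncurry (λ x y → o x y ∧ S x y)
  ¬oS = uncurry (λ x y → not (o x y) ∧ S x y)
  swap↣ : (A × A) ↣ (A × A)
  swap↣ = mk↣ {to = swap} (cong swap)
  flip : ∀ x y → oS (y , x) ≡ ¬oS (x , y)
  flip x y with S x y in Sxy
  ... | false = trans (cong (o y x ∧_) (trans (S-sym y x) Sxy)) (trans (∧-zeroʳ _) (sym (∧-zeroʳ _)))
  ... | true  = cong₂ _∧_ (o-tour x≢y) (trans (S-sym y x) Sxy)
    where
    x≢y : x ≢ y
    x≢y refl with () ← trans (sym Sxy) (S-irr x)
  swapped : count oS pairs ≡ count ¬oS pairs
  swapped = trans (count-image swap↣ (allPairs-enumerates enum) (allPairs-enumerates enum) oS (λ {y} _ → swap y , refl))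
                  (count-cong pairs (λ {(x , y)} _ → flip x y))

count-tournament-invariant : {A : Set} {xs : List A} → Enumerates xs → (o o′ S : A → A → Bool) → Tournament o → Tournament o′ →
  (∀ x y → S x y ≡ S y x) → (∀ x → S x x ≡ false) →
  count (uncurry (λ x y → o x y ∧ S x y)) (allPairs xs) ≡ count (uncurry (λ x y → o′ x y ∧ S x y)) (allPairs xs)
count-tournament-invariant enum o o′ S o-tour o′-tour S-sym S-irr =
  *-cancelˡ-≡ _ _ 2 (trans (count-tournament enum o S o-tour S-sym S-irr) (sym (count-tournament enum o′ S o′-tour S-sym S-irr)))

T-injective : {x y : Bool} → (T x → T y) → (T y → T x) → x ≡ y
T-injective {false} {false} _ _ = refl
T-injective {false} {true}  _ g = ⊥-elim (g tt)
T-injective {true}  {false} f _ = ⊥-elim (f tt)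
T-injective {true}  {true}  _ _ = refl

adj-∪ : (G H : Graph n) (i j : Fin n) → adj (G ∪ H) i j ≡ adj G i j ∨ adj H i j
adj-∪ {suc n} (r , G) (s , H) zero    zero    = refl
adj-∪ {suc n} (r , G) (s , H) zero    (suc j) = lookup-zipWith _ j r s
adj-∪ {suc n} (r , G) (s , H) (suc i) zero    = lookup-zipWith _ i r s
adj-∪ {suc n} (r , G) (s , H) (suc i) (suc j) = adj-∪ G H i j

adj-empty : (i j : Fin n) → adj (empty {n}) i j ≡ false
adj-empty {suc n} zero    zero    = refl
adj-empty {suc n} zero    (suc j) = lookup-replicate j false
adj-empty {suc n} (suc i) zero    = lookup-replicate i false
adj-empty {suc n} (suc i) (suc j) = adj-empty i j

adj-sym : (G : Graph n) (i j : Fin n) → adj G i j ≡ adj G j i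
adj-sym {suc n} G       zero    zero    = refl
adj-sym {suc n} G       zero    (suc j) = refl
adj-sym {suc n} G       (suc i) zero    = refl
adj-sym {suc n} (r , G) (suc i) (suc j) = adj-sym G i j

adj-irrefl : (G : Graph n) (i : Fin n) → adj G i i ≡ false
adj-irrefl {suc n} G       zero    = refl
adj-irrefl {suc n} (r , G) (suc i) = adj-irrefl G i

adj⇒≢ : (G : Graph n) {i j : Fin n} → T (adj G i j) → i ≢ j
adj⇒≢ G {i} t refl = subst T (adj-irrefl G i) t

adj-ext : {G H : Graph n} → (∀ i j → adj G i j ≡ adj H i j) → G ≡ H
adj-ext {zero}              _ = refl
adj-ext {suc n} {r , G} {s , H} e =
  cong₂ _,_ (trans (sym (tabulate∘lookup r)) (trans (tabulate-cong (λ j → e zero (suc j))) (tabulate∘lookup s)))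
            (adj-ext (λ i j → e (suc i) (suc j)))

infix 4 _⊆_

_⊆_ : Graph n → Graph n → Set
G ⊆ H = ∀ {i j} → T (adj G i j) → T (adj H i j)

⊆-antisym : {G H : Graph n} → G ⊆ H → H ⊆ G → G ≡ H
⊆-antisym G⊆H H⊆G = adj-ext (λ i j → T-injective G⊆H H⊆G)

T-adj-∪ : (G H : Graph n) {i j : Fin n} → T (adj (G ∪ H) i j) ⇔ (T (adj G i j) ⊎ T (adj H i j))
T-adj-∪ G H {i} {j} rewrite adj-∪ G H i j = T-∨

∪-upperˡ : (G H : Graph n) → G ⊆ G ∪ H
∪-upperˡ G H = Equivalence.from (T-adj-∪ G H) ∘ inj₁

∪-upperʳ : (G H : Graph n) → H ⊆ G ∪ H
∪-upperʳ G H = Equivalence.from (T-adj-∪ G H) ∘ inj₂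

∪-least : {G H K : Graph n} → G ⊆ K → H ⊆ K → G ∪ H ⊆ K
∪-least {G = G} {H} G⊆K H⊆K t with Equivalence.to (T-adj-∪ G H) t
... | inj₁ tG = G⊆K tG
... | inj₂ tH = H⊆K tH

∪-absorbʳ : {G H : Graph n} → H ⊆ G → G ∪ H ≡ G
∪-absorbʳ {G = G} {H} H⊆G = ⊆-antisym (∪-least {G = G} {H} {G} (λ t → t) H⊆G) (∪-upperˡ G H)

empty-least : (G : Graph n) → empty ⊆ G
empty-least G {i} {j} t = ⊥-elim (subst T (adj-empty i j) t)

∪-identityʳ : (G : Graph n) → G ∪ empty ≡ G
∪-identityʳ G = ∪-absorbʳ (empty-least G)

-- Only the entries p i j with i < j are read.
fromAdj : (Fin n → Fin n → Bool) → Graph n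
fromAdj {zero}  p = tt
fromAdj {suc n} p = tabulate (p zero ∘ suc) , fromAdj (λ i j → p (suc i) (suc j))

adj-fromAdj : (p : Fin n → Fin n → Bool) → (∀ i j → p i j ≡ p j i) → (∀ i → p i i ≡ false) →
  ∀ i j → adj (fromAdj p) i j ≡ p i j
adj-fromAdj {suc n} p p-sym p-irr zero    zero    = sym (p-irr zero)
adj-fromAdj {suc n} p p-sym p-irr zero    (suc j) = lookup∘tabulate _ j
adj-fromAdj {suc n} p p-sym p-irr (suc i) zero    = trans (lookup∘tabulate _ i) (p-sym zero (suc i))
adj-fromAdj {suc n} p p-sym p-irr (suc i) (suc j) =
  adj-fromAdj (λ i j → p (suc i) (suc j)) (λ i j → p-sym (suc i) (suc j)) (p-irr ∘ suc) i j

Endpoints : Fin n → Fin n → Fin n → Fin n → Set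
Endpoints a b i j = (i ≡ a × j ≡ b) ⊎ (i ≡ b × j ≡ a)

endpoints? : (a b i j : Fin n) → Dec (Endpoints a b i j)
endpoints? a b i j = (i ≟ a ×-dec j ≟ b) ⊎-dec (i ≟ b ×-dec j ≟ a)

endpoints-swap : {a b i j : Fin n} → Endpoints a b i j → Endpoints a b j i
endpoints-swap (inj₁ (i≡a , j≡b)) = inj₂ (j≡b , i≡a)
endpoints-swap (inj₂ (i≡b , j≡a)) = inj₁ (j≡a , i≡b)

endpoints-flip : {a b i j : Fin n} → Endpoints a b i j → Endpoints b a i j
endpoints-flip (inj₁ e) = inj₂ e
endpoints-flip (inj₂ e) = inj₁ e

edge : Fin n → Fin n → Graph n
edge a b = fromAdj (λ i j → ⌊ endpoints? a b i j ⌋)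

T-endpoints? : {a b i j : Fin n} → T (⌊ endpoints? a b i j ⌋) ⇔ Endpoints a b i j
T-endpoints? {a = a} {b} {i} {j} = mk⇔ (toWitness {a? = endpoints? a b i j}) fromWitness

T-adj-edge : {a b : Fin n} → a ≢ b → ∀ {i j} → T (adj (edge a b) i j) ⇔ Endpoints a b i j
T-adj-edge {a = a} {b} a≢b {i} {j} =
  mk⇔ (Equivalence.to T-endpoints? ∘ subst T adj≡) (subst T (sym adj≡) ∘ Equivalence.from T-endpoints?)
  where
  e-sym : ∀ i j → ⌊ endpoints? a b i j ⌋ ≡ ⌊ endpoints? a b j i ⌋
  e-sym i j = T-injective (swapped {i} {j}) (swapped {j} {i})
    where
    swapped : ∀ {i j} → T (⌊ endpoints? a b i j ⌋) → T (⌊ endpoints? a b j i ⌋)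
    swapped = Equivalence.from T-endpoints? ∘ endpoints-swap ∘ Equivalence.to T-endpoints?
  loop-free : ∀ {i} → ¬ Endpoints a b i i
  loop-free (inj₁ (refl , refl)) = a≢b refl
  loop-free (inj₂ (refl , refl)) = a≢b refl
  e-irr : ∀ i → ⌊ endpoints? a b i i ⌋ ≡ false
  e-irr i = T-injective (loop-free ∘ Equivalence.to T-endpoints?) λ ()
  adj≡ : adj (edge a b) i j ≡ ⌊ endpoints? a b i j ⌋
  adj≡ = adj-fromAdj _ e-sym e-irr i j

edge-sym : {a b : Fin n} → a ≢ b → edge a b ≡ edge b a
edge-sym a≢b = ⊆-antisym
  (Equivalence.from (T-adj-edge (a≢b ∘ sym)) ∘ endpoints-flip ∘ Equivalence.to (T-adj-edge a≢b))
  (Equivalence.from (T-adj-edge a≢b) ∘ endpoints-flip ∘ Equivalence.to (T-adj-edge (a≢b ∘ sym)))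

edge-⊆ : (G : Graph n) {a b : Fin n} → T (adj G a b) → edge a b ⊆ G
edge-⊆ G {a} {b} Gab t with Equivalence.to (T-adj-edge (adj⇒≢ G Gab)) t
... | inj₁ (refl , refl) = Gab
... | inj₂ (refl , refl) = subst T (adj-sym G a b) Gab

⊆-edge : {G : Graph n} {a b : Fin n} → a ≢ b → G ⊆ edge a b → G ≡ empty ⊎ G ≡ edge a b
⊆-edge {G = G} {a} {b} a≢b G⊆ab with adj G a b in Gab
... | true  = inj₂ (⊆-antisym G⊆ab (edge-⊆ G (subst T (sym Gab) tt)))
... | false = inj₁ (⊆-antisym G⊆∅ (empty-least G))
  where
  G⊆∅ : G ⊆ empty
  G⊆∅ {i} {j} t with Equivalence.to (T-adj-edge a≢b) (G⊆ab t)
  ... | inj₁ (refl , refl) = ⊥-elim (subst T Gab t)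
  ... | inj₂ (refl , refl) = ⊥-elim (subst T (trans (adj-sym G b a) Gab) t)

⋃ : List (Graph n) → Graph n
⋃ = foldr _∪_ empty

⋃-upper : {gs : List (Graph n)} {g : Graph n} → g ∈ gs → g ⊆ ⋃ gs
⋃-upper {gs = g ∷ gs} (here refl) = ∪-upperˡ g (⋃ gs)
⋃-upper {gs = g ∷ gs} (there g∈)  = ∪-upperʳ g (⋃ gs) ∘ ⋃-upper g∈

⋃-least : {gs : List (Graph n)} {G : Graph n} → (∀ {g} → g ∈ gs → g ⊆ G) → ⋃ gs ⊆ G
⋃-least {gs = []}     {G} _   = empty-least G
⋃-least {gs = g ∷ gs} {G} gs⊆ = ∪-least {G = g} {⋃ gs} {G} (gs⊆ (here refl)) (⋃-least (gs⊆ ∘ there))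

isEdge : Graph n → Fin n × Fin n → Bool
isEdge G (i , j) = (toℕ i <ᵇ toℕ j) ∧ adj G i j

∈-edges⁺ : (G : Graph n) {i j : Fin n} → T (toℕ i <ᵇ toℕ j) → T (adj G i j) → (i , j) ∈ edges G
∈-edges⁺ G {i} {j} i<j Gij =
  ∈-filter⁺ _ (∈-cartesianProduct⁺ (∈-allFin i) (∈-allFin j)) (Equivalence.from T-∧ (i<j , Gij))

∈-edges⁻ : (G : Graph n) {i j : Fin n} → (i , j) ∈ edges G → T (toℕ i <ᵇ toℕ j) × T (adj G i j)
∈-edges⁻ G e∈ = Equivalence.to T-∧ (proj₂ (∈-filter⁻ (T? ∘ isEdge G) {xs = allPairs (allFin _)} e∈))

edgeGraphs : Graph n → List (Graph n)
edgeGraphs G = map (uncurry edge) (edges G)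

⋃-edgeGraphs : (G : Graph n) → ⋃ (edgeGraphs G) ≡ G
⋃-edgeGraphs G = ⊆-antisym (⋃-least each⊆G) G⊆⋃
  where
  each⊆G : ∀ {g} → g ∈ edgeGraphs G → g ⊆ G
  each⊆G g∈ with ∈-map⁻ (uncurry edge) g∈
  ... | _ , e∈ , refl = edge-⊆ G (proj₂ (∈-edges⁻ G e∈))
  G⊆⋃ : G ⊆ ⋃ (edgeGraphs G)
  G⊆⋃ {i} {j} Gij with <-cmp i j
  ... | tri< i<j _ _ = ⋃-upper (∈-map⁺ (uncurry edge) (∈-edges⁺ G (<⇒<ᵇ i<j) Gij))
                         (Equivalence.from (T-adj-edge (adj⇒≢ G Gij)) (inj₁ (refl , refl)))
  ... | tri≈ _ i≡j _ = ⊥-elim (adj⇒≢ G Gij i≡j)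
  ... | tri> _ _ j<i = ⋃-upper (∈-map⁺ (uncurry edge) (∈-edges⁺ G (<⇒<ᵇ j<i) (subst T (adj-sym G i j) Gij)))
                         (Equivalence.from (T-adj-edge (adj⇒≢ G Gij ∘ sym)) (inj₂ (refl , refl)))

module _ {L : Graph n → Graph n} (linear : Linear L) where

  linear-mono : {G H : Graph n} → G ⊆ H → L G ⊆ L H
  linear-mono {G} {H} G⊆H = subst (L G ⊆_) LH∪LG≡LH (∪-upperʳ (L H) (L G))
    where
    LH∪LG≡LH : L H ∪ L G ≡ L H
    LH∪LG≡LH = trans (sym (proj₁ linear H G)) (cong L (∪-absorbʳ G⊆H))

  linear-⋃-fixed : {gs : List (Graph n)} → (∀ {g} → g ∈ gs → L g ≡ g) → L (⋃ gs) ≡ ⋃ gs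
  linear-⋃-fixed {[]}     _     = proj₂ linear
  linear-⋃-fixed {g ∷ gs} fixed =
    trans (proj₁ linear g (⋃ gs)) (cong₂ _∪_ (fixed (here refl)) (linear-⋃-fixed (fixed ∘ there)))

  fixes-edges⇒identity : (∀ {a b} → a ≢ b → L (edge a b) ≡ edge a b) → ∀ G → L G ≡ G
  fixes-edges⇒identity fixes G = subst (λ K → L K ≡ K) (⋃-edgeGraphs G) (linear-⋃-fixed fixed)
    where
    fixed : ∀ {g} → g ∈ edgeGraphs G → L g ≡ g
    fixed g∈ with ∈-map⁻ (uncurry edge) g∈
    ... | _ , e∈ , refl = fixes (adj⇒≢ G (proj₂ (∈-edges⁻ G e∈)))

identity⇒bijective : {A : Set} {f : A → A} → (∀ x → f x ≡ x) → Bijective _≡_ _≡_ f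
identity⇒bijective f≡id =
  (λ {x} {y} fx≡fy → trans (sym (f≡id x)) (trans fx≡fy (f≡id y))) , λ y → y , λ {z} z≡y → trans (f≡id z) z≡y

[]↣ : Fin 0 ↣ Fin n
[]↣ = mk↣ {to = Vector.[]} λ {}

cons↣ : (v : Fin n) (ι : Fin k ↣ Fin n) → (∀ i → v ≢ to ι i) → Fin (suc k) ↣ Fin n
cons↣ v ι fresh = mk↣ {to = v Vector.∷ to ι} inj
  where
  inj : ∀ {i j} → (v Vector.∷ to ι) i ≡ (v Vector.∷ to ι) j → i ≡ j
  inj {zero}  {zero}  _ = refl
  inj {zero}  {suc j} e = ⊥-elim (fresh j e)
  inj {suc i} {zero}  e = ⊥-elim (fresh i (sym e))
  inj {suc i} {suc j} e = cong suc (injective ι e)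

pair↣ : {a b : Fin n} → a ≢ b → Fin 2 ↣ Fin n
pair↣ {a = a} {b} a≢b = cons↣ a (cons↣ b []↣ λ ()) λ { zero → a≢b }

triple↣ : {a b c : Fin n} → a ≢ b → a ≢ c → b ≢ c → Fin 3 ↣ Fin n
triple↣ {a = a} a≢b a≢c b≢c = cons↣ a (pair↣ b≢c) λ { zero → a≢b ; (suc zero) → a≢c }

quadruple↣ : {a b c d : Fin n} → a ≢ b → a ≢ c → a ≢ d → b ≢ c → b ≢ d → c ≢ d → Fin 4 ↣ Fin n
quadruple↣ {a = a} a≢b a≢c a≢d b≢c b≢d c≢d =
  cons↣ a (triple↣ b≢c b≢d c≢d) λ { zero → a≢b ; (suc zero) → a≢c ; (suc (suc zero)) → a≢d }

fresh : k < n → (ι : Fin k ↣ Fin n) → ∃ λ v → ∀ i → v ≢ to ι i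
fresh {k} {n} k<n ι with any? (λ v → all? (λ i → ¬? (v ≟ to ι i)))
... | yes found = found
... | no none   = ⊥-elim (<⇒≱ k<n (injective⇒≤ {f = preimage} preimage-injective))
  where
  hit : ∀ v → ∃ λ i → v ≡ to ι i
  hit v with ¬∀⟶∃¬ k (λ i → v ≢ to ι i) (λ i → ¬? (v ≟ to ι i)) (λ all → none (v , all))
  ... | i , ¬v≢ιi = i , decidable-stable (v ≟ to ι i) ¬v≢ιi
  preimage : Fin n → Fin k
  preimage v = proj₁ (hit v)
  preimage-injective : ∀ {v w} → preimage v ≡ preimage w → v ≡ w
  preimage-injective {v} {w} e = trans (proj₂ (hit v)) (trans (cong (to ι) e) (sym (proj₂ (hit w))))

pad : (m : ℕ) → m + k ≤ n → Fin k ↣ Fin n → Fin (m + k) ↣ Fin n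
pad zero    _      ι = ι
pad (suc m) m+k<n ι = cons↣ (proj₁ v) ι′ (proj₂ v)
  where
  ι′ = pad m (<⇒≤ m+k<n) ι
  v = fresh m+k<n ι′

pad-raise : (m : ℕ) (m+k≤n : m + k ≤ n) (ι : Fin k ↣ Fin n) (i : Fin k) → to (pad m m+k≤n ι) (m ↑ʳ i) ≡ to ι i
pad-raise zero    _      ι i = refl
pad-raise (suc m) m+k<n ι i = pad-raise m (<⇒≤ m+k<n) ι i

-- Strong preservers of a separated property are the identity

Distinguishes : (Graph n → Set) → Graph n → Graph n → Set
Distinguishes X G H = (X G × ¬ X H) ⊎ (¬ X G × X H)

Separates : (Graph n → Set) → Graph n → Graph n → Graph n → Set
Separates X base e H = base ⊆ H × Distinguishes X (H ∪ e) H

record Separating (X : Graph n → Set) : Set where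
  field
    single   : (ι : Fin 2 ↣ Fin n) → ∃ λ H → Distinguishes X (H ∪ edge (to ι (# 0)) (to ι (# 1))) H
    disjoint : (ι : Fin 4 ↣ Fin n) → ∃ (Separates X (edge (to ι (# 0)) (to ι (# 1))) (edge (to ι (# 2)) (to ι (# 3))))
    adjacent : (ι : Fin 3 ↣ Fin n) → ∃ (Separates X (edge (to ι (# 0)) (to ι (# 1))) (edge (to ι (# 0)) (to ι (# 2))))

module StrongPreserver {X : Graph n → Set} {L : Graph n → Graph n}
  (linear : Linear L) (idempotent : ∀ G → L (L G) ≡ L G) (preserves : StronglyPreserves X L)
  (separating : Separating X) where
  open Separating separating

  L-separates : {G H : Graph n} → Distinguishes X G H → L G ≢ L H
  L-separates {G} {H} (inj₁ (XG , ¬XH)) LG≡LH = proj₂ (preserves H) ¬XH (subst X LG≡LH (proj₁ (preserves G) XG))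
  L-separates {G} {H} (inj₂ (¬XG , XH)) LG≡LH = proj₂ (preserves G) ¬XG (subst X (sym LG≡LH) (proj₁ (preserves H) XH))

  absorbed : {a b x y : Fin n} {H : Graph n} → T (adj (L (edge a b)) x y) → edge a b ⊆ H → L (H ∪ edge x y) ≡ L H
  absorbed {a} {b} {x} {y} {H} xy∈ ab⊆H = trans (proj₁ linear H (edge x y)) (∪-absorbʳ (L-ab⊆L-H ∘ L-xy⊆L-ab))
    where
    L-xy⊆L-ab : L (edge x y) ⊆ L (edge a b)
    L-xy⊆L-ab = subst (L (edge x y) ⊆_) (idempotent (edge a b)) (linear-mono linear (edge-⊆ (L (edge a b)) xy∈))
    L-ab⊆L-H : L (edge a b) ⊆ L H
    L-ab⊆L-H = linear-mono linear ab⊆H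

  module _ {a b x y : Fin n} (a≢b : a ≢ b) (xy∈ : T (adj (L (edge a b)) x y)) where

    private
      x≢y : x ≢ y
      x≢y = adj⇒≢ (L (edge a b)) xy∈

      refute : ∃ (Separates X (edge a b) (edge x y)) → ⊥
      refute (H , ab⊆H , d) = L-separates d (absorbed xy∈ ab⊆H)

      flipped-base : ∀ {e} → ∃ (Separates X (edge b a) e) → ∃ (Separates X (edge a b) e)
      flipped-base (H , ba⊆H , d) = H , subst (_⊆ H) (edge-sym (a≢b ∘ sym)) ba⊆H , d

      flipped-edge : ∀ {base} → ∃ (Separates X base (edge y x)) → ∃ (Separates X base (edge x y))
      flipped-edge (H , base⊆H , d) = H , base⊆H , subst (λ e → Distinguishes X (H ∪ e) H) (edge-sym (x≢y ∘ sym)) d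

    L-edge-endpoints : Endpoints a b x y
    L-edge-endpoints with x ≟ a | x ≟ b | y ≟ a | y ≟ b
    ... | yes refl | _        | _        | yes refl = inj₁ (refl , refl)
    ... | _        | yes refl | yes refl | _        = inj₂ (refl , refl)
    ... | yes refl | _        | _        | no y≢b   =
      ⊥-elim (refute (adjacent (triple↣ a≢b x≢y (y≢b ∘ sym))))
    ... | no x≢a   | yes refl | no y≢a   | _        =
      ⊥-elim (refute (flipped-base (adjacent (triple↣ (a≢b ∘ sym) x≢y (y≢a ∘ sym)))))
    ... | no x≢a   | no x≢b   | yes refl | _        =
      ⊥-elim (refute (flipped-edge (adjacent (triple↣ a≢b (x≢a ∘ sym) (x≢b ∘ sym)))))
    ... | no x≢a   | no x≢b   | no y≢a   | yes refl =
      ⊥-elim (refute (flipped-edge (flipped-base (adjacent (triple↣ (a≢b ∘ sym) (x≢b ∘ sym) (x≢a ∘ sym))))))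
    ... | no x≢a   | no x≢b   | no y≢a   | no y≢b   =
      ⊥-elim (refute (disjoint (quadruple↣ a≢b (x≢a ∘ sym) (y≢a ∘ sym) (x≢b ∘ sym) (y≢b ∘ sym) x≢y)))

  L-edge : {a b : Fin n} → a ≢ b → L (edge a b) ≡ edge a b
  L-edge {a} {b} a≢b with ⊆-edge a≢b (Equivalence.from (T-adj-edge a≢b) ∘ L-edge-endpoints a≢b)
  ... | inj₂ L-ab≡ab = L-ab≡ab
  ... | inj₁ L-ab≡∅ with single (pair↣ a≢b)
  ...   | H , d = ⊥-elim (L-separates d (trans (proj₁ linear H (edge a b)) (trans (cong (L H ∪_) L-ab≡∅) (∪-identityʳ (L H)))))

  identity : ∀ G → L G ≡ G
  identity = fixes-edges⇒identity linear L-edge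

-- Embedding a graph along an injective vertex map

<ᵇ-true : {i j : Fin n} → i Fin.< j → (toℕ i <ᵇ toℕ j) ≡ true
<ᵇ-true i<j = T-injective (λ _ → tt) (λ _ → <⇒<ᵇ i<j)

<ᵇ-false : {i j : Fin n} → ¬ i Fin.< j → (toℕ i <ᵇ toℕ j) ≡ false
<ᵇ-false i≮j = T-injective (i≮j ∘ <ᵇ⇒< _ _) λ ()

<ᵇ-tournament : Tournament (λ (i j : Fin n) → toℕ i <ᵇ toℕ j)
<ᵇ-tournament {x = i} {j} i≢j with <-cmp i j
... | tri< i<j _ j≮i = trans (<ᵇ-false j≮i) (cong not (sym (<ᵇ-true i<j)))
... | tri≈ _ i≡j _   = ⊥-elim (i≢j i≡j)
... | tri> i≮j _ j<i = trans (<ᵇ-true j<i) (cong not (sym (<ᵇ-false i≮j)))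

T-any-allFin : (p : Fin n → Bool) → T (any p (allFin n)) ⇔ ∃ λ i → T (p i)
T-any-allFin {n} p = mk⇔ (satisfied ∘ any⁻ p (allFin n)) (λ (i , pi) → any⁺ {xs = allFin n} p (lose (∈-allFin i) pi))

module Embedding (ι : Fin k ↣ Fin n) where

  Outside : Fin n → Set
  Outside x = ∀ u → to ι u ≢ x

  image? : (x : Fin n) → Dec (∃ λ u → to ι u ≡ x)
  image? x = any? (λ u → to ι u ≟ x)

  image-or-outside : (x : Fin n) → (∃ λ u → to ι u ≡ x) ⊎ Outside x
  image-or-outside x with image? x
  ... | yes found = inj₁ found
  ... | no none   = inj₂ (λ u e → none (u , e))

  extend : {A : Set} → A → (Fin k → A) → Fin n → A
  extend d h x with image? x
  ... | yes (u , _) = h u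
  ... | no _        = d

  extend-image : {A : Set} (d : A) (h : Fin k → A) (u : Fin k) → extend d h (to ι u) ≡ h u
  extend-image d h u with image? (to ι u)
  ... | yes (w , ιw≡ιu) = cong h (injective ι ιw≡ιu)
  ... | no none         = ⊥-elim (none (u , refl))

  extend-outside : {A : Set} (d : A) (h : Fin k → A) {x : Fin n} → Outside x → extend d h x ≡ d
  extend-outside d h {x} out with image? x
  ... | yes (u , ιu≡x) = ⊥-elim (out u ιu≡x)
  ... | no _           = refl

  extend₂ : {A : Set} → A → (Fin k → Fin k → A) → Fin n → Fin n → A
  extend₂ d h x y = extend d (λ u → extend d (h u) y) x

  extend₂-image : {A : Set} (d : A) (h : Fin k → Fin k → A) (u v : Fin k) → extend₂ d h (to ι u) (to ι v) ≡ h u v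
  extend₂-image d h u v = trans (extend-image d _ u) (extend-image d (h u) v)

  module _ (K : Graph k) where

    embedAdj : Fin n → Fin n → Bool
    embedAdj = extend₂ false (adj K)

    embedAdj-image : ∀ u v → embedAdj (to ι u) (to ι v) ≡ adj K u v
    embedAdj-image = extend₂-image false (adj K)

    embedAdj-outsideˡ : ∀ {x} y → Outside x → embedAdj x y ≡ false
    embedAdj-outsideˡ y = extend-outside false _

    embedAdj-outsideʳ : ∀ x {y} → Outside y → embedAdj x y ≡ false
    embedAdj-outsideʳ x out with image-or-outside x
    ... | inj₁ (u , refl) = trans (extend-image false _ u) (extend-outside false (adj K u) out)
    ... | inj₂ out-x      = extend-outside false _ out-x

    embedAdj-sym : ∀ x y → embedAdj x y ≡ embedAdj y x
    embedAdj-sym x y with image-or-outside x | image-or-outside y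
    ... | inj₁ (u , refl) | inj₁ (v , refl) =
      trans (embedAdj-image u v) (trans (adj-sym K u v) (sym (embedAdj-image v u)))
    ... | inj₂ out-x | _ = trans (embedAdj-outsideˡ y out-x) (sym (embedAdj-outsideʳ y out-x))
    ... | _ | inj₂ out-y = trans (embedAdj-outsideʳ x out-y) (sym (embedAdj-outsideˡ x out-y))

    embedAdj-irrefl : ∀ x → embedAdj x x ≡ false
    embedAdj-irrefl x with image-or-outside x
    ... | inj₁ (u , refl) = trans (embedAdj-image u u) (adj-irrefl K u)
    ... | inj₂ out-x      = embedAdj-outsideˡ x out-x

  embed : Graph k → Graph n
  embed K = fromAdj (embedAdj K)

  adj-embed : (K : Graph k) → ∀ x y → adj (embed K) x y ≡ embedAdj K x y
  adj-embed K = adj-fromAdj (embedAdj K) (embedAdj-sym K) (embedAdj-irrefl K)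

  adj-embed-image : (K : Graph k) → ∀ u v → adj (embed K) (to ι u) (to ι v) ≡ adj K u v
  adj-embed-image K u v = trans (adj-embed K _ _) (embedAdj-image K u v)

  adj-embed-outside : (K : Graph k) → ∀ {x} y → Outside x → adj (embed K) x y ≡ false
  adj-embed-outside K y out = trans (adj-embed K _ y) (embedAdj-outsideˡ K y out)

  embed-unique : (K : Graph k) (G : Graph n) → (∀ u v → adj G (to ι u) (to ι v) ≡ adj K u v) →
    (∀ {x} y → Outside x → adj G x y ≡ false) → G ≡ embed K
  embed-unique K G on-image off-image = adj-ext same
    where
    same : ∀ x y → adj G x y ≡ adj (embed K) x y
    same x y with image-or-outside x | image-or-outside y
    ... | inj₁ (u , refl) | inj₁ (v , refl) = trans (on-image u v) (sym (adj-embed-image K u v))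
    ... | inj₂ out-x | _ = trans (off-image y out-x) (sym (adj-embed-outside K y out-x))
    ... | _ | inj₂ out-y = trans (adj-sym G x y) (trans (off-image x out-y)
                             (sym (trans (adj-sym (embed K) x y) (adj-embed-outside K x out-y))))

  embed-∪ : (K K′ : Graph k) → embed (K ∪ K′) ≡ embed K ∪ embed K′
  embed-∪ K K′ = sym (embed-unique (K ∪ K′) (embed K ∪ embed K′) on-image off-image)
    where
    on-image : ∀ u v → adj (embed K ∪ embed K′) (to ι u) (to ι v) ≡ adj (K ∪ K′) u v
    on-image u v = trans (adj-∪ (embed K) (embed K′) _ _)
                     (trans (cong₂ _∨_ (adj-embed-image K u v) (adj-embed-image K′ u v)) (sym (adj-∪ K K′ u v)))
    off-image : ∀ {x} y → Outside x → adj (embed K ∪ embed K′) x y ≡ false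
    off-image y out = trans (adj-∪ (embed K) (embed K′) _ y) (cong₂ _∨_ (adj-embed-outside K y out) (adj-embed-outside K′ y out))

  embed-edge : {u v : Fin k} → u ≢ v → embed (edge u v) ≡ edge (to ι u) (to ι v)
  embed-edge {u} {v} u≢v = sym (embed-unique (edge u v) (edge (to ι u) (to ι v)) on-image off-image)
    where
    ιu≢ιv : to ι u ≢ to ι v
    ιu≢ιv = u≢v ∘ injective ι
    ι-endpoints : ∀ {w w′} → Endpoints (to ι u) (to ι v) (to ι w) (to ι w′) → Endpoints u v w w′
    ι-endpoints (inj₁ (e , e′)) = inj₁ (injective ι e , injective ι e′)
    ι-endpoints (inj₂ (e , e′)) = inj₂ (injective ι e , injective ι e′)
    on-image : ∀ w w′ → adj (edge (to ι u) (to ι v)) (to ι w) (to ι w′) ≡ adj (edge u v) w w′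
    on-image w w′ = T-injective
      (Equivalence.from (T-adj-edge u≢v) ∘ ι-endpoints ∘ Equivalence.to (T-adj-edge ιu≢ιv))
      (Equivalence.from (T-adj-edge ιu≢ιv) ∘ ι-endpoints⁻¹ ∘ Equivalence.to (T-adj-edge u≢v))
      where
      ι-endpoints⁻¹ : Endpoints u v w w′ → Endpoints (to ι u) (to ι v) (to ι w) (to ι w′)
      ι-endpoints⁻¹ (inj₁ (refl , refl)) = inj₁ (refl , refl)
      ι-endpoints⁻¹ (inj₂ (refl , refl)) = inj₂ (refl , refl)
    off-image : ∀ {x} y → Outside x → adj (edge (to ι u) (to ι v)) x y ≡ false
    off-image y out = T-injective (no-endpoint ∘ Equivalence.to (T-adj-edge ιu≢ιv)) λ ()
      where
      no-endpoint : ¬ Endpoints (to ι u) (to ι v) _ y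
      no-endpoint (inj₁ (x≡ιu , _)) = out u (sym x≡ιu)
      no-endpoint (inj₂ (x≡ιv , _)) = out v (sym x≡ιv)

  nonIsolated-embed : (K : Graph k) (u : Fin k) → nonIsolated (embed K) (to ι u) ≡ nonIsolated K u
  nonIsolated-embed K u = T-injective embed⇒K K⇒embed
    where
    embed⇒K : T (nonIsolated (embed K) (to ι u)) → T (nonIsolated K u)
    embed⇒K t with Equivalence.to (T-any-allFin _) t
    ... | y , uy with image-or-outside y
    ...   | inj₁ (v , refl) = Equivalence.from (T-any-allFin _) (v , subst T (adj-embed-image K u v) uy)
    ...   | inj₂ out-y      = ⊥-elim (subst T (trans (adj-sym (embed K) _ y) (adj-embed-outside K _ out-y)) uy)
    K⇒embed : T (nonIsolated K u) → T (nonIsolated (embed K) (to ι u))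
    K⇒embed t with Equivalence.to (T-any-allFin _) t
    ... | v , uv = Equivalence.from (T-any-allFin _) (to ι v , subst T (sym (adj-embed-image K u v)) uv)

  nonIsolated-outside : (K : Graph k) {x : Fin n} → Outside x → nonIsolated (embed K) x ≡ false
  nonIsolated-outside K out = T-injective isolated λ ()
    where
    isolated : T (nonIsolated (embed K) _) → ⊥
    isolated t with Equivalence.to (T-any-allFin _) t
    ... | y , xy = subst T (adj-embed-outside K y out) xy

  adj-embed⇒image : (K : Graph k) {x y : Fin n} → T (adj (embed K) x y) → ∃ λ u → to ι u ≡ x
  adj-embed⇒image K {x} {y} t with image-or-outside x
  ... | inj₁ found = found
  ... | inj₂ out   = ⊥-elim (subst T (adj-embed-outside K y out) t)

  count-nonIsolated-embed : (K : Graph k) (q : Fin n → Bool) →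
    count (λ x → nonIsolated (embed K) x ∧ q x) (allFin n) ≡ count (λ u → nonIsolated K u ∧ q (to ι u)) (allFin k)
  count-nonIsolated-embed K q =
    trans (count-image ι allFin-enumerates allFin-enumerates _ on-image)
          (count-cong (allFin k) (λ {u} _ → cong (_∧ q (to ι u)) (nonIsolated-embed K u)))
    where
    on-image : ∀ {x} → T (nonIsolated (embed K) x ∧ q x) → ∃ λ u → to ι u ≡ x
    on-image {x} t with image-or-outside x
    ... | inj₁ found = found
    ... | inj₂ out   = ⊥-elim (subst T (nonIsolated-outside K out) (proj₁ (Equivalence.to T-∧ t)))

  ι² : (Fin k × Fin k) ↣ (Fin n × Fin n)
  ι² = mk↣ {to = Product.map (to ι) (to ι)} λ e → cong₂ _,_ (injective ι (cong proj₁ e)) (injective ι (cong proj₂ e))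

  -- edges lists each edge as (i , j) with i < j, an order that ι need not preserve; this is harmless for symmetric q.
  count-edges-embed : (K : Graph k) (q : Fin n × Fin n → Bool) → (∀ x y → q (x , y) ≡ q (y , x)) →
    count q (edges (embed K)) ≡ count (q ∘ to ι²) (edges K)
  count-edges-embed K q q-sym = begin
    count q (edges (embed K))
      ≡⟨ count-filterᵇ q (isEdge (embed K)) (allPairs (allFin n)) ⟩
    count (λ e → isEdge (embed K) e ∧ q e) (allPairs (allFin n))
      ≡⟨ count-image ι² (allPairs-enumerates allFin-enumerates) (allPairs-enumerates allFin-enumerates) _ on-image ⟩
    count (λ e → isEdge (embed K) (to ι² e) ∧ q (to ι² e)) (allPairs (allFin k))
      ≡⟨ count-cong (allPairs (allFin k)) (λ {(u , v)} _ → reassoc u v) ⟩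
    count (uncurry (λ u v → ι-ordered u v ∧ S u v)) (allPairs (allFin k))
      ≡⟨ count-tournament-invariant allFin-enumerates ι-ordered ordered S
           (tournament-∘ <ᵇ-tournament (injective ι)) <ᵇ-tournament S-sym S-irrefl ⟩
    count (uncurry (λ u v → ordered u v ∧ S u v)) (allPairs (allFin k))
      ≡⟨ count-cong (allPairs (allFin k)) (λ {(u , v)} _ → sym (∧-assoc (ordered u v) (adj K u v) _)) ⟩
    count (λ e → isEdge K e ∧ q (to ι² e)) (allPairs (allFin k))
      ≡⟨ count-filterᵇ (q ∘ to ι²) (isEdge K) (allPairs (allFin k)) ⟨
    count (q ∘ to ι²) (edges K) ∎
    where
    open ≡-Reasoning
    ordered ι-ordered S : Fin k → Fin k → Bool
    ordered u v   = toℕ u <ᵇ toℕ v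
    ι-ordered u v = toℕ (to ι u) <ᵇ toℕ (to ι v)
    S u v         = adj K u v ∧ q (to ι u , to ι v)
    S-sym : ∀ u v → S u v ≡ S v u
    S-sym u v = cong₂ _∧_ (adj-sym K u v) (q-sym _ _)
    S-irrefl : ∀ u → S u u ≡ false
    S-irrefl u = cong (_∧ q _) (adj-irrefl K u)
    reassoc : ∀ u v → isEdge (embed K) (to ι u , to ι v) ∧ q (to ι u , to ι v) ≡ ι-ordered u v ∧ S u v
    reassoc u v = trans (cong (λ b → (ι-ordered u v ∧ b) ∧ q _) (adj-embed-image K u v)) (∧-assoc (ι-ordered u v) (adj K u v) _)
    on-image : ∀ {e} → T (isEdge (embed K) e ∧ q e) → ∃ λ d → to ι² d ≡ e
    on-image {x , y} t with Equivalence.to (T-∧ {toℕ x <ᵇ toℕ y}) (proj₁ (Equivalence.to (T-∧ {isEdge (embed K) (x , y)}) t))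
    ... | _ , xy with adj-embed⇒image K xy | adj-embed⇒image K (subst T (adj-sym (embed K) x y) xy)
    ...   | u , refl | v , refl = (u , v) , refl

-- The three labelling properties are invariant under embedding

Near-≡ : {a a′ b b′ : ℕ} → a ≡ a′ → b ≡ b′ → Near a b ⇔ Near a′ b′
Near-≡ refl refl = mk⇔ id id

vertexFriendly-≗ : (G : Graph n) {f g : Fin n → Bool} → f ≗ g → VertexFriendly G f → VertexFriendly G g
vertexFriendly-≗ {n} G {f} {g} f≗g = Equivalence.to (Near-≡ (same false) (same true))
  where
  same : ∀ t → count (λ v → nonIsolated G v ∧ eqB (f v) t) (allFin n) ≡ count (λ v → nonIsolated G v ∧ eqB (g v) t) (allFin n)
  same t = count-cong (allFin _) (λ {v} _ → cong (λ b → nonIsolated G v ∧ eqB b t) (f≗g v))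

edgeFriendly-≗ : (G : Graph n) (op : Bool → Bool → Bool) {f g : Fin n → Bool} → f ≗ g →
  EdgeFriendly G op f → EdgeFriendly G op g
edgeFriendly-≗ G op {f} {g} f≗g = Equivalence.to (Near-≡ (same false) (same true))
  where
  same : ∀ t → count (λ (i , j) → eqB (op (f i) (f j)) t) (edges G) ≡ count (λ (i , j) → eqB (op (g i) (g j)) t) (edges G)
  same t = count-cong (edges G) (λ {(i , j)} _ → cong₂ (λ x y → eqB (op x y) t) (f≗g i) (f≗g j))

Cordial : (Bool → Bool → Bool) → Graph n → Set
Cordial op G = ∃ λ f → VertexFriendly G f × EdgeFriendly G op f

arcLab : Bool → Bool → Bool → Lab
arcLab b x y = if b then diffL x y else diffL y x

arcLab-flip : ∀ b x y → arcLab (not b) y x ≡ arcLab b x y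
arcLab-flip true  x y = refl
arcLab-flip false x y = refl

arcLabel-arcLab : (o : Fin n → Fin n → Bool) (f : Fin n → Bool) (i j : Fin n) → arcLabel o f (i , j) ≡ arcLab (o i j) (f i) (f j)
arcLabel-arcLab o f i j with o i j
... | true  = refl
... | false = refl

-- o only matters on pairs i < j; directed o i j says whether the arc between i and j runs from i to j.
directed : (Fin n → Fin n → Bool) → Fin n → Fin n → Bool
directed o i j = if toℕ i <ᵇ toℕ j then o i j else not (o j i)

directed-< : (o : Fin n → Fin n → Bool) {i j : Fin n} → T (toℕ i <ᵇ toℕ j) → directed o i j ≡ o i j
directed-< o {i} {j} i<j with toℕ i <ᵇ toℕ j
... | true = refl

directed-flip : (o : Fin n → Fin n → Bool) {i j : Fin n} → i ≢ j → directed o j i ≡ not (directed o i j)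
directed-flip o {i} {j} i≢j rewrite <ᵇ-tournament {x = i} {j} i≢j with toℕ i <ᵇ toℕ j
... | true  = refl
... | false = sym (not-involutive _)

directed-≡ : (o : Fin n → Fin n → Bool) {i j : Fin n} → o j i ≡ not (o i j) → directed o i j ≡ o i j
directed-≡ o {i} {j} oji with toℕ i <ᵇ toℕ j
... | true  = refl
... | false = trans (cong not oji) (not-involutive _)

edgeLabel : (Fin n → Fin n → Bool) → (Fin n → Bool) → Fin n × Fin n → Lab
edgeLabel o f (i , j) = arcLab (directed o i j) (f i) (f j)

edgeLabel-sym : (o : Fin n → Fin n → Bool) (f : Fin n → Bool) (i j : Fin n) → edgeLabel o f (i , j) ≡ edgeLabel o f (j , i)
edgeLabel-sym o f i j with i ≟ j
... | yes refl = refl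
... | no i≢j   = trans (sym (arcLab-flip _ (f i) (f j))) (cong (λ b → arcLab b (f j) (f i)) (sym (directed-flip o i≢j)))

arcCount : Graph n → (Fin n → Fin n → Bool) → (Fin n → Bool) → Lab → ℕ
arcCount G o f l = count (λ e → eqL (arcLabel o f e) l) (edges G)

arcCount-edgeLabel : (G : Graph n) (o : Fin n → Fin n → Bool) (f : Fin n → Bool) (l : Lab) →
  arcCount G o f l ≡ count (λ e → eqL (edgeLabel o f e) l) (edges G)
arcCount-edgeLabel G o f l = count-cong (edges G) λ {(i , j)} e∈ →
  cong (λ x → eqL x l) (trans (arcLabel-arcLab o f i j)
    (cong (λ b → arcLab b (f i) (f j)) (sym (directed-< o (proj₁ (∈-edges⁻ G e∈))))))

z3Friendly-transport : {G : Graph n} {G′ : Graph k} {o : Fin n → Fin n → Bool} {f : Fin n → Bool}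
  {o′ : Fin k → Fin k → Bool} {f′ : Fin k → Bool} →
  (∀ l → arcCount G o f l ≡ arcCount G′ o′ f′ l) → Z3Friendly G o f → Z3Friendly G′ o′ f′
z3Friendly-transport same (n₋₀ , n₀₊ , n₋₊) =
  Equivalence.to (Near-≡ (same neg) (same zer)) n₋₀ ,
  Equivalence.to (Near-≡ (same zer) (same pos)) n₀₊ ,
  Equivalence.to (Near-≡ (same neg) (same pos)) n₋₊

module _ (ι : Fin k ↣ Fin n) where
  open Embedding ι

  vertexFriendly-embed : (K : Graph k) (f : Fin n → Bool) → VertexFriendly (embed K) f ⇔ VertexFriendly K (f ∘ to ι)
  vertexFriendly-embed K f =
    Near-≡ (count-nonIsolated-embed K (λ v → eqB (f v) false)) (count-nonIsolated-embed K (λ v → eqB (f v) true))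

  edgeFriendly-embed : (K : Graph k) (op : Bool → Bool → Bool) → (∀ x y → op x y ≡ op y x) → (f : Fin n → Bool) →
    EdgeFriendly (embed K) op f ⇔ EdgeFriendly K op (f ∘ to ι)
  edgeFriendly-embed K op op-comm f =
    Near-≡ (count-edges-embed K (labelled false) (labelled-sym false)) (count-edges-embed K (labelled true) (labelled-sym true))
    where
    labelled : Bool → Fin n × Fin n → Bool
    labelled t (i , j) = eqB (op (f i) (f j)) t
    labelled-sym : ∀ t x y → labelled t (x , y) ≡ labelled t (y , x)
    labelled-sym t x y = cong (λ b → eqB b t) (op-comm (f x) (f y))

  cordial-embed : (op : Bool → Bool → Bool) → (∀ x y → op x y ≡ op y x) → (K : Graph k) → Cordial op (embed K) ⇔ Cordial op K
  cordial-embed op op-comm K = mk⇔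
    (λ (f , vf , ef) → f ∘ to ι , Equivalence.to (vertexFriendly-embed K f) vf , Equivalence.to (edgeFriendly-embed K op op-comm f) ef)
    (λ (g , vf , ef) → extend false g ,
       Equivalence.from (vertexFriendly-embed K (extend false g)) (vertexFriendly-≗ K (sym ∘ extend-image false g) vf) ,
       Equivalence.from (edgeFriendly-embed K op op-comm (extend false g)) (edgeFriendly-≗ K op (sym ∘ extend-image false g) ef))

  arcCount-embed : (K : Graph k) (o : Fin n → Fin n → Bool) (f : Fin n → Bool) (o′ : Fin k → Fin k → Bool) (f′ : Fin k → Bool) →
    (∀ {u v} → u ≢ v → edgeLabel o f (to ι u , to ι v) ≡ edgeLabel o′ f′ (u , v)) →
    ∀ l → arcCount (embed K) o f l ≡ arcCount K o′ f′ l
  arcCount-embed K o f o′ f′ same-label l = begin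
    arcCount (embed K) o f l                                 ≡⟨ arcCount-edgeLabel (embed K) o f l ⟩
    count (λ e → eqL (edgeLabel o f e) l) (edges (embed K))  ≡⟨ count-edges-embed K _ (λ i j → cong (λ x → eqL x l) (edgeLabel-sym o f i j)) ⟩
    count (λ e → eqL (edgeLabel o f (to ι² e)) l) (edges K)  ≡⟨ count-cong (edges K) (λ {(u , v)} e∈ → cong (λ x → eqL x l) (same-label (adj⇒≢ K (proj₂ (∈-edges⁻ K e∈))))) ⟩
    count (λ e → eqL (edgeLabel o′ f′ e) l) (edges K)        ≡⟨ arcCount-edgeLabel K o′ f′ l ⟨
    arcCount K o′ f′ l                                       ∎
    where open ≡-Reasoning

  orientable-embed : (K : Graph k) → Orientable23 (embed K) ⇔ Orientable23 K
  orientable-embed K = mk⇔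
    (λ (o , f , vf , z) → pull o , f ∘ to ι , Equivalence.to (vertexFriendly-embed K f) vf ,
       z3Friendly-transport {G = embed K} {K} {o} {f} {pull o} {f ∘ to ι} (arcCount-embed K o f (pull o) (f ∘ to ι) (pulled o {f})) z)
    (λ (o′ , g , vf , z) → push o′ , extend false g ,
       Equivalence.from (vertexFriendly-embed K (extend false g)) (vertexFriendly-≗ K (sym ∘ extend-image false g) vf) ,
       z3Friendly-transport {G = K} {embed K} {o′} {g} {push o′} {extend false g} (λ l → sym (arcCount-embed K (push o′) (extend false g) o′ g (pushed o′ g) l)) z)
    where
    pull : (Fin n → Fin n → Bool) → Fin k → Fin k → Bool
    pull o u v = directed o (to ι u) (to ι v)
    push : (Fin k → Fin k → Bool) → Fin n → Fin n → Bool
    push o′ = extend₂ false (directed o′)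
    pulled : ∀ o {f} {u v} → u ≢ v → edgeLabel o f (to ι u , to ι v) ≡ edgeLabel (pull o) (f ∘ to ι) (u , v)
    pulled o {u = u} {v} u≢v = cong (λ b → arcLab b _ _) (sym (directed-≡ (pull o) (directed-flip o (u≢v ∘ injective ι))))
    pushed : ∀ o′ g {u v} → u ≢ v → edgeLabel (push o′) (extend false g) (to ι u , to ι v) ≡ edgeLabel o′ g (u , v)
    pushed o′ g {u} {v} u≢v =
      trans (cong (λ b → arcLab b _ _) push-directed) (cong₂ (arcLab _) (extend-image false g u) (extend-image false g v))
      where
      push-directed : directed (push o′) (to ι u) (to ι v) ≡ directed o′ u v
      push-directed = trans (directed-≡ (push o′) (trans (extend₂-image false _ v u)
                              (trans (directed-flip o′ u≢v) (cong not (sym (extend₂-image false _ u v))))))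
                            (extend₂-image false _ u v)

monoCount : Graph n → (Fin n → Bool) → ℕ
monoCount G f = count (λ (i , j) → eqB (f i) (f j)) (edges G)

eqL-arcLab-zer : ∀ b x y → eqL (arcLab b x y) zer ≡ eqB x y
eqL-arcLab-zer true  false false = refl
eqL-arcLab-zer true  false true  = refl
eqL-arcLab-zer true  true  false = refl
eqL-arcLab-zer true  true  true  = refl
eqL-arcLab-zer false false false = refl
eqL-arcLab-zer false false true  = refl
eqL-arcLab-zer false true  false = refl
eqL-arcLab-zer false true  true  = refl

count-labels : {A : Set} (ℓ : A → Lab) (xs : List A) →
  count (λ x → eqL (ℓ x) neg) xs + count (λ x → eqL (ℓ x) zer) xs + count (λ x → eqL (ℓ x) pos) xs ≡ length xs
count-labels ℓ [] = refl
count-labels ℓ (x ∷ xs) with ℓ x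
... | neg = cong suc (count-labels ℓ xs)
... | zer = trans (cong (_+ count (λ x → eqL (ℓ x) pos) xs) (+-suc (count (λ x → eqL (ℓ x) neg) xs) _))
                  (cong suc (count-labels ℓ xs))
... | pos = trans (+-suc (count (λ x → eqL (ℓ x) neg) xs + count (λ x → eqL (ℓ x) zer) xs) _)
                  (cong suc (count-labels ℓ xs))

middle-of-three : {a b c : ℕ} → a + b + c ≡ 3 → Near a b → Near b c → b ≡ 1
middle-of-three {b = 1} _ _ _ = refl
middle-of-three {a} {0} {c} sum (a≤1 , _) (_ , c≤1)
  with s≤s (s≤s ()) ← subst (_≤ 2) sum (+-mono-≤ (+-mono-≤ a≤1 (z≤n {0})) c≤1)
middle-of-three {a} {suc (suc b)} {c} sum (_ , s≤s b+1≤a) (s≤s b+1≤c , _)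
  with s≤s (s≤s (s≤s ())) ← subst (4 ≤_) sum
         (+-mono-≤ (+-mono-≤ (≤-trans (s≤s z≤n) b+1≤a) (s≤s (s≤s (z≤n {b})))) (≤-trans (s≤s z≤n) b+1≤c))

-- Three arcs with Z₃-friendly labels carry one label each; the arcs labelled 0 are the monochromatic edges.
orientable-three-edges : (G : Graph n) → length (edges G) ≡ 3 → Orientable23 G →
  ∃ λ f → VertexFriendly G f × monoCount G f ≡ 1
orientable-three-edges G three (o , f , vf , n₋₀ , n₀₊ , _) = f , vf , trans (sym zeros) (middle-of-three total n₋₀ n₀₊)
  where
  zeros : arcCount G o f zer ≡ monoCount G f
  zeros = count-cong (edges G) λ {(i , j)} _ → trans (cong (λ x → eqL x zer) (arcLabel-arcLab o f i j)) (eqL-arcLab-zer _ _ _)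
  total : arcCount G o f neg + arcCount G o f zer + arcCount G o f pos ≡ 3
  total = trans (count-labels (arcLabel o f) (edges G)) three

near? : (a b : ℕ) → Dec (Near a b)
near? a b = (a ≤? suc b) ×-dec (b ≤? suc a)

labelings : (k : ℕ) → List (Fin k → Bool)
labelings zero    = Vector.[] ∷ []
labelings (suc k) = cartesianProductWith Vector._∷_ (false ∷ true ∷ []) (labelings k)

labelings-complete : (f : Fin k → Bool) → ∃ λ g → g ∈ labelings k × f ≗ g
labelings-complete {zero}  f = Vector.[] , here refl , λ ()
labelings-complete {suc k} f with labelings-complete (f ∘ suc)
... | g , g∈ , f≗g = f zero Vector.∷ g , ∈-cartesianProductWith⁺ Vector._∷_ (bool∈ (f zero)) g∈ , λ { zero → refl ; (suc i) → f≗g i }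
  where
  bool∈ : ∀ b → b ∈ false ∷ true ∷ []
  bool∈ false = here refl
  bool∈ true  = there (here refl)

∃-labeling? : {P : (Fin k → Bool) → Set} → (∀ {f g} → f ≗ g → P f → P g) → (∀ f → Dec (P f)) → Dec (∃ P)
∃-labeling? {k} P-resp P? with Any.any? P? (labelings k)
... | yes found = yes (satisfied found)
... | no none   = no λ (f , pf) → let (g , g∈ , f≗g) = labelings-complete f in none (lose g∈ (P-resp f≗g pf))

vertexFriendly? : (G : Graph n) (f : Fin n → Bool) → Dec (VertexFriendly G f)
vertexFriendly? G f = near? _ _

edgeFriendly? : (G : Graph n) (op : Bool → Bool → Bool) (f : Fin n → Bool) → Dec (EdgeFriendly G op f)
edgeFriendly? G op f = near? _ _

z3Friendly? : (G : Graph n) (o : Fin n → Fin n → Bool) (f : Fin n → Bool) → Dec (Z3Friendly G o f)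
z3Friendly? G o f = near? _ _ ×-dec near? _ _ ×-dec near? _ _

cordial? : (op : Bool → Bool → Bool) (G : Graph k) → Dec (Cordial op G)
cordial? op G = ∃-labeling? (λ f≗g (vf , ef) → vertexFriendly-≗ G f≗g vf , edgeFriendly-≗ G op f≗g ef)
                            (λ f → vertexFriendly? G f ×-dec edgeFriendly? G op f)

monoCount-≗ : (G : Graph n) {f g : Fin n → Bool} → f ≗ g → monoCount G f ≡ monoCount G g
monoCount-≗ G f≗g = count-cong (edges G) λ {(i , j)} _ → cong₂ eqB (f≗g i) (f≗g j)

one-monochromatic? : (G : Graph k) → Dec (∃ λ f → VertexFriendly G f × monoCount G f ≡ 1)
one-monochromatic? G = ∃-labeling? (λ f≗g (vf , m) → vertexFriendly-≗ G f≗g vf , trans (sym (monoCount-≗ G f≗g)) m)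
                                   (λ f → vertexFriendly? G f ×-dec (monoCount G f ℕ.≟ 1))

-- Witness graphs

EmbeddingInvariant : (∀ {n} → Graph n → Set) → Set
EmbeddingInvariant X = ∀ {k n} (ι : Fin k ↣ Fin n) (K : Graph k) → X (Embedding.embed ι K) ⇔ X K

module Placement (X : ∀ {n} → Graph n → Set) (X-embed : EmbeddingInvariant X) where

  distinguishes-embed : (ι : Fin k ↣ Fin n) {K K′ : Graph k} → Distinguishes X K K′ →
    Distinguishes X (Embedding.embed ι K) (Embedding.embed ι K′)
  distinguishes-embed ι {K} {K′} (inj₁ (XK , ¬XK′)) = inj₁ (Equivalence.from (X-embed ι K) XK , ¬XK′ ∘ Equivalence.to (X-embed ι K′))
  distinguishes-embed ι {K} {K′} (inj₂ (¬XK , XK′)) = inj₂ (¬XK ∘ Equivalence.to (X-embed ι K) , Equivalence.from (X-embed ι K′) XK′)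

  -- K is placed on the vertices of ι, preceded by m fresh vertices.
  module _ {j n : ℕ} (m : ℕ) (m+j≤n : m + j ≤ n) (ι : Fin j ↣ Fin n) (K : Graph (m + j)) where
    open Embedding (pad m m+j≤n ι)

    placed-edge : {u v : Fin j} → u ≢ v → edge (to ι u) (to ι v) ≡ embed (edge (m ↑ʳ u) (m ↑ʳ v))
    placed-edge {u} {v} u≢v = trans (cong₂ edge (sym (pad-raise m m+j≤n ι u)) (sym (pad-raise m m+j≤n ι v)))
                                    (sym (embed-edge (u≢v ∘ ↑ʳ-injective m u v)))

    placed-⊆ : {u v : Fin j} → T (adj K (m ↑ʳ u) (m ↑ʳ v)) → edge (to ι u) (to ι v) ⊆ embed K
    placed-⊆ {u} {v} uv∈K = edge-⊆ (embed K)
      (subst₂ (λ x y → T (adj (embed K) x y)) (pad-raise m m+j≤n ι u) (pad-raise m m+j≤n ι v)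
        (subst T (sym (adj-embed-image K _ _)) uv∈K))

    placed-distinguishes : {u v : Fin j} → u ≢ v → Distinguishes X (K ∪ edge (m ↑ʳ u) (m ↑ʳ v)) K →
      Distinguishes X (embed K ∪ edge (to ι u) (to ι v)) (embed K)
    placed-distinguishes {u} {v} u≢v d = subst (λ G → Distinguishes X G (embed K)) embed-K∪uv (distinguishes-embed _ d)
      where
      embed-K∪uv : embed (K ∪ edge (m ↑ʳ u) (m ↑ʳ v)) ≡ embed K ∪ edge (to ι u) (to ι v)
      embed-K∪uv = trans (embed-∪ K _) (cong (embed K ∪_) (sym (placed-edge u≢v)))

    placed-separates : {a b u v : Fin j} → T (adj K (m ↑ʳ a) (m ↑ʳ b)) → u ≢ v →
      Distinguishes X (K ∪ edge (m ↑ʳ u) (m ↑ʳ v)) K →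
      ∃ (Separates X (edge (to ι a) (to ι b)) (edge (to ι u) (to ι v)))
    placed-separates ab∈K u≢v d = embed K , placed-⊆ ab∈K , placed-distinguishes u≢v d

plusCordial-embed : EmbeddingInvariant Z2PlusCordial
plusCordial-embed ι = cordial-embed ι _xor_ xor-comm

timesCordial-embed : EmbeddingInvariant Z2TimesCordial
timesCordial-embed ι = cordial-embed ι _∧_ ∧-comm

-- In the adjacent configuration the fresh vertex is 0 and a, b, c are 1, 2, 3.
K₂ 2K₂ 2K₂′ P₄ : Graph 4
K₂  = edge (# 0) (# 1)
2K₂ = K₂ ∪ edge (# 2) (# 3)
2K₂′ = edge (# 1) (# 2) ∪ edge (# 3) (# 0)
P₄  = 2K₂′ ∪ edge (# 1) (# 3)

plusCordial-separating : 4 ≤ n → Separating (Z2PlusCordial {n})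
plusCordial-separating 4≤n = record
  { single   = λ ι → _ , placed-distinguishes 2 4≤n ι K₂ (λ ()) (inj₂ (from-no (cordial? _xor_ 2K₂) , from-yes (cordial? _xor_ K₂)))
  ; disjoint = λ ι → placed-separates 0 4≤n ι K₂ _ (λ ()) (inj₂ (from-no (cordial? _xor_ 2K₂) , from-yes (cordial? _xor_ K₂)))
  ; adjacent = λ ι → placed-separates 1 4≤n ι 2K₂′ _ (λ ()) (inj₁ (from-yes (cordial? _xor_ P₄) , from-no (cordial? _xor_ 2K₂′)))
  }
  where open Placement Z2PlusCordial plusCordial-embed

K₁,₃ paw P₄′ paw′ : Graph 4
K₁,₃ = (edge (# 0) (# 1) ∪ edge (# 0) (# 2)) ∪ edge (# 0) (# 3)
paw  = K₁,₃ ∪ edge (# 2) (# 3)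
P₄′  = (edge (# 0) (# 1) ∪ edge (# 1) (# 2)) ∪ edge (# 2) (# 3)
paw′ = P₄′ ∪ edge (# 1) (# 3)

timesCordial-separating : 4 ≤ n → Separating (Z2TimesCordial {n})
timesCordial-separating 4≤n = record
  { single   = λ ι → _ , placed-distinguishes 2 4≤n ι K₁,₃ (λ ()) (inj₂ (from-no (cordial? _∧_ paw) , from-yes (cordial? _∧_ K₁,₃)))
  ; disjoint = λ ι → placed-separates 0 4≤n ι K₁,₃ _ (λ ()) (inj₂ (from-no (cordial? _∧_ paw) , from-yes (cordial? _∧_ K₁,₃)))
  ; adjacent = λ ι → placed-separates 1 4≤n ι P₄′ _ (λ ()) (inj₂ (from-no (cordial? _∧_ paw′) , from-yes (cordial? _∧_ P₄′)))
  }
  where open Placement Z2TimesCordial timesCordial-embed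

forward : Fin n → Fin n → Bool
forward _ _ = true

2K₂⁶ 3K₂ 3K₂′ P₄+K₂ : Graph 6
2K₂⁶  = edge (# 0) (# 1) ∪ edge (# 2) (# 3)
3K₂   = 2K₂⁶ ∪ edge (# 4) (# 5)
3K₂′  = (edge (# 3) (# 4) ∪ edge (# 0) (# 1)) ∪ edge (# 2) (# 5)
P₄+K₂ = 3K₂′ ∪ edge (# 3) (# 5)

2K₂⁶-orientable : Orientable23 2K₂⁶
2K₂⁶-orientable = forward , f , from-yes (vertexFriendly? 2K₂⁶ f ×-dec z3Friendly? 2K₂⁶ forward f)
  where
  f : Fin 6 → Bool
  f = lookup (false ∷ true ∷ true ∷ false ∷ false ∷ false ∷ [])

P₄+K₂-orientable : Orientable23 P₄+K₂
P₄+K₂-orientable = forward , f , from-yes (vertexFriendly? P₄+K₂ f ×-dec z3Friendly? P₄+K₂ forward f)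
  where
  f : Fin 6 → Bool
  f = lookup (false ∷ true ∷ false ∷ true ∷ false ∷ true ∷ [])

3K₂-not-orientable : ¬ Orientable23 3K₂
3K₂-not-orientable = from-no (one-monochromatic? 3K₂) ∘ orientable-three-edges 3K₂ refl

3K₂′-not-orientable : ¬ Orientable23 3K₂′
3K₂′-not-orientable = from-no (one-monochromatic? 3K₂′) ∘ orientable-three-edges 3K₂′ refl

orientable-separating : 6 ≤ n → Separating (Orientable23 {n})
orientable-separating 6≤n = record
  { single   = λ ι → _ , placed-distinguishes 4 6≤n ι 2K₂⁶ (λ ()) (inj₂ (3K₂-not-orientable , 2K₂⁶-orientable))
  ; disjoint = λ ι → placed-separates 2 6≤n ι 2K₂⁶ _ (λ ()) (inj₂ (3K₂-not-orientable , 2K₂⁶-orientable))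
  ; adjacent = λ ι → placed-separates 3 6≤n ι 3K₂′ _ (λ ()) (inj₁ (P₄+K₂-orientable , 3K₂′-not-orientable))
  }
  where open Placement Orientable23 orientable-embed

mainTheorem4 : (n : ℕ) (L : Graph n → Graph n) → Linear L → (∀ U → L (L U) ≡ L U) →
    ((4 ≤ n × StronglyPreserves Z2PlusCordial L) ⊎ (4 ≤ n × StronglyPreserves Z2TimesCordial L) ⊎ (6 ≤ n × StronglyPreserves Orientable23 L)) →
    Bijective _≡_ _≡_ L
mainTheorem4 n L linear idempotent (inj₁ (4≤n , preserves)) =
  identity⇒bijective (StrongPreserver.identity linear idempotent preserves (plusCordial-separating 4≤n))
mainTheorem4 n L linear idempotent (inj₂ (inj₁ (4≤n , preserves))) =
  identity⇒bijective (StrongPreserver.identity linear idempotent preserves (timesCordial-separating 4≤n))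
mainTheorem4 n L linear idempotent (inj₂ (inj₂ (6≤n , preserves))) =
  identity⇒bijective (StrongPreserver.identity linear idempotent preserves (orientable-separating 6≤n))
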